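{- For each $n\in\omega$ there are $N\in\omega$ and a set $C\subseteq 2^{N}$ such that for all $s_0,\dots,s_{n-1}\in 2^N$ we have $\bigcap_{k<n}(C+s_k)\neq\emptyset$ and $\bigcap_{k<n}\big((2^N\setminus C)+s_k\big)\neq\emptyset$.
   Context: $2^N$ is the set of 0-1 sequences of length $N$ with coordinatewise addition modulo 2, denoted $+$; $C+s=\{c+s:c\in C\}$. -}

module Defs where

open import Data.Bool using (Bool; true; false; _xor_; not)
open import Data.Nat using (ℕ)
open import Data.Vec using (Vec; zipWith)
open import Data.Product using (Σ; ∃; _×_)
open import Relation.Binary.PropositionalEquality using (_≡_)

2^ : ℕ → Set
2^ N = Vec Bool N

_⊕_ : {N : ℕ} → 2^ N → 2^ N → 2^ N
_⊕_ = zipWith _xor_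

Subset2 : ℕ → Set
Subset2 N = 2^ N → Bool

_∈ₛ_ : {N : ℕ} → 2^ N → Subset2 N → Set
x ∈ₛ C = C x ≡ true

compl : {N : ℕ} → Subset2 N → Subset2 N
compl C x = not (C x)

_∈_+ₛ_ : {N : ℕ} → 2^ N → Subset2 N → 2^ N → Set
x ∈ C +ₛ s = ∃ λ c → (c ∈ₛ C) × (x ≡ c ⊕ s)

-- View 2^(n·n) as n × n matrices and let C be the set of matrices with a row of
-- ones. Given s₀,…,s_{n-1}, the matrix x with x(i,j) = ¬ s_i(i,j) makes row k of
-- x + s_k all ones, so x lies in every C + s_k; the matrix x with
-- x(i,j) = s_j(i,j) makes column k of x + s_k all zeros, so x + s_k has no row of
-- ones and x lies in every (2^(n·n) ∖ C) + s_k.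
module Submission where

open import Defs
open import Data.Bool using (Bool; true; false; not; _xor_; _≟_)
open import Data.Bool.Properties using (xor-assoc; xor-same; xor-identityʳ; xor-inverseˡ; not-¬; T-≡)
open import Data.Fin using (Fin; combine; remQuot)
open import Data.Fin.Properties using (any?; all?; remQuot-combine)
open import Data.Nat using (ℕ; _*_)
open import Data.Product using (Σ; ∃; _×_; _,_; uncurry)
open import Data.Vec using (lookup; tabulate; replicate)
open import Data.Vec.Properties using (lookup-zipWith; lookup∘tabulate; zipWith-assoc; zipWith-inverseʳ; zipWith-identityʳ; map-id)
open import Function using (_∘_; Equivalence)
open import Relation.Nullary.Decidable using (⌊_⌋; fromWitness; fromWitnessFalse)
open import Relation.Binary.PropositionalEquality using (_≡_; sym; trans; cong; module ≡-Reasoning)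

private
  variable
    N : ℕ

⊕-cancelʳ : (x s : 2^ N) → (x ⊕ s) ⊕ s ≡ x
⊕-cancelʳ {N} x s = begin
  (x ⊕ s) ⊕ s                ≡⟨ zipWith-assoc xor-assoc x s s ⟩
  x ⊕ (s ⊕ s)                ≡⟨ cong (x ⊕_) s⊕s≡0 ⟩
  x ⊕ replicate N false      ≡⟨ zipWith-identityʳ xor-identityʳ x ⟩
  x                          ∎
  where
  open ≡-Reasoning
  s⊕s≡0 : s ⊕ s ≡ replicate N false
  s⊕s≡0 = trans (cong (s ⊕_) (sym (map-id s))) (zipWith-inverseʳ xor-same s)

∈-+ₛ-intro : (C : Subset2 N) {x s : 2^ N} → (x ⊕ s) ∈ₛ C → x ∈ C +ₛ s
∈-+ₛ-intro C {x} {s} x⊕s∈C = x ⊕ s , x⊕s∈C , sym (⊕-cancelʳ x s)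

module Matrices (m n : ℕ) where

  Matrix : Set
  Matrix = 2^ (m * n)

  entry : Matrix → Fin m → Fin n → Bool
  entry x i j = lookup x (combine i j)

  matrix : (Fin m → Fin n → Bool) → Matrix
  matrix f = tabulate (uncurry f ∘ remQuot n)

  entry-matrix : (f : Fin m → Fin n → Bool) (i : Fin m) (j : Fin n) →
                 entry (matrix f) i j ≡ f i j
  entry-matrix f i j =
    trans (lookup∘tabulate _ (combine i j)) (cong (uncurry f) (remQuot-combine i j))

  entry-⊕ : (x y : Matrix) (i : Fin m) (j : Fin n) →
            entry (x ⊕ y) i j ≡ entry x i j xor entry y i j
  entry-⊕ x y i j = lookup-zipWith _xor_ (combine i j) x y

  hasRowOfOnes : Subset2 (m * n)
  hasRowOfOnes x = ⌊ any? (λ i → all? (λ j → entry x i j ≟ true)) ⌋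

  hasRowOfOnes-intro : (x : Matrix) (i : Fin m) →
                       (∀ j → entry x i j ≡ true) → x ∈ₛ hasRowOfOnes
  hasRowOfOnes-intro x i row = Equivalence.to T-≡ (fromWitness (i , row))

  hasRowOfOnes-reject : (x : Matrix) (j : Fin n) →
                        (∀ i → entry x i j ≡ false) → x ∈ₛ compl hasRowOfOnes
  hasRowOfOnes-reject x j column =
    Equivalence.to T-≡ (fromWitnessFalse λ (i , row) → not-¬ (column i) (row j))

  complementRows : (Fin m → Matrix) → Matrix
  complementRows s = matrix λ i j → not (entry (s i) i j)

  copyColumns : (Fin n → Matrix) → Matrix
  copyColumns s = matrix λ i j → entry (s j) i j

  complementRows-⊕-row : (s : Fin m → Matrix) (k : Fin m) (j : Fin n) →
                         entry (complementRows s ⊕ s k) k j ≡ true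
  complementRows-⊕-row s k j = begin
    entry (complementRows s ⊕ s k) k j                ≡⟨ entry-⊕ (complementRows s) (s k) k j ⟩
    entry (complementRows s) k j xor entry (s k) k j  ≡⟨ cong (_xor entry (s k) k j) (entry-matrix (λ i j → not (entry (s i) i j)) k j) ⟩
    not (entry (s k) k j) xor entry (s k) k j         ≡⟨ xor-inverseˡ (entry (s k) k j) ⟩
    true                                              ∎
    where open ≡-Reasoning

  copyColumns-⊕-column : (s : Fin n → Matrix) (k : Fin n) (i : Fin m) →
                         entry (copyColumns s ⊕ s k) i k ≡ false
  copyColumns-⊕-column s k i = begin
    entry (copyColumns s ⊕ s k) i k                ≡⟨ entry-⊕ (copyColumns s) (s k) i k ⟩
    entry (copyColumns s) i k xor entry (s k) i k  ≡⟨ cong (_xor entry (s k) i k) (entry-matrix (λ i j → entry (s j) i j) i k) ⟩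
    entry (s k) i k xor entry (s k) i k            ≡⟨ xor-same (entry (s k) i k) ⟩
    false                                          ∎
    where open ≡-Reasoning

lemma2p2 : (n : ℕ) → Σ ℕ λ N → Σ (Subset2 N) λ C →
    (s : Fin n → 2^ N) →
      (∃ λ x → (k : Fin n) → x ∈ C +ₛ s k)
      × (∃ λ x → (k : Fin n) → x ∈ compl C +ₛ s k)
lemma2p2 n = n * n , hasRowOfOnes , λ s →
    (complementRows s , λ k →
       ∈-+ₛ-intro hasRowOfOnes (hasRowOfOnes-intro (complementRows s ⊕ s k) k (complementRows-⊕-row s k)))
  , (copyColumns s , λ k →
       ∈-+ₛ-intro (compl hasRowOfOnes) (hasRowOfOnes-reject (copyColumns s ⊕ s k) k (copyColumns-⊕-column s k)))
  where open Matrices n n
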